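{- For every subgroup $H\le G_{d,k}$, the multicomplex $\widetilde{\mathfrak X}_{d,k}(H)$ is link-connected.
   Context: $G_{d,k}=\langle\alpha_0,\dots,\alpha_d\mid\alpha_i^k=e\rangle$ ($d,k\ge1$), $[\![d]\!]=\{0,\dots,d\}$. For $J\subseteq[\![d]\!]$, $K_J=\langle\alpha_j:j\in J\rangle$, $\widehat J=[\![d]\!]\setminus J$, $\widehat i=\widehat{\{i\}}$. For $H\le G_{d,k}$, cosets $K_{\widehat J}g$ and $K_{\widehat{J'}}g'$ are equivalent if $\{K_{\widehat J}gh:h\in H\}=\{K_{\widehat{J'}}g'h:h\in H\}$; $[K_{\widehat J}g]_H$ denotes the class (equivalent cosets have $J=J'$), and $\mathcal M(H)$ the set of all classes. $\Phi([K_{\widehat J}g]_H)=\{[K_{\widehat i}g]_H:i\in J\}$ is well defined, and $\mathfrak X_{d,k}(H)=\Phi(\mathcal M(H))$ is a $d$-dimensional simplicial complex on the vertex set $\{[K_{\widehat i}g]_H\}$. The multicomplex $\widetilde{\mathfrak X}_{d,k}(H)$ has underlying complex $\mathfrak X_{d,k}(H)$; its multicells over a cell $\sigma$ are the elements of $\Phi^{ -1}(\sigma)$ (dimension $|J|-1$ for $[K_{\widehat J}g]_H$), and the multicells in the (multi)boundary of $[K_{\widehat J}g]_H$ are $[K_{\widehat{J\setminus\{l\}}}g]_H$, $l\in J$; containment $\preceq$ of multicells is the reflexive-transitive closure of this boundary relation. The link of a multicell $\mathfrak a$ with $\rho=\Phi(\mathfrak a)$ is the multicomplex whose multicells over a cell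 $\tau$ disjoint from $\rho$ are the multicells $\mathfrak b\succeq\mathfrak a$ with $\Phi(\mathfrak b)=\rho\cup\tau$, with boundary relation induced from that of $\widetilde{\mathfrak X}_{d,k}(H)$. A $d$-multicomplex is link-connected if for every multicell of dimension at most $d-2$ (including the $(-1)$-dimensional one) the 1-skeleton of its link is a connected multigraph, i.e. any two 0-multicells of the link are joined by a sequence in which consecutive ones lie in a common 1-multicell of the link. -}

module Defs where

open import Data.Nat using (ℕ; suc; _∸_; _+_; _≤_)
open import Data.Fin using (Fin)
open import Data.Fin.Subset using (Subset; _∈_; _∉_; _-_; ∣_∣)
open import Data.List using (List; []; _++_; replicate; reverse; concatMap)
open import Data.List.Relation.Unary.All using (All)
open import Data.Product using (Σ; ∃; _×_; _,_)
open import Data.Sum using (_⊎_)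
open import Relation.Binary.PropositionalEquality using (_≡_)
open import Relation.Binary.Construct.Closure.ReflexiveTransitive using (Star)

-- Elements of G_{d,k} = < α_0..α_d | α_i^k = e > are represented by words in the
-- (positive) generators α_i, i ∈ Fin (suc d) = [[d]] (α_i⁻¹ = α_i^(k-1)),
-- up to the congruence generated by α_i^k = e.  Product is concatenation.
Word : ℕ → Set
Word d = List (Fin (suc d))

data _≈[_]_ {d : ℕ} : Word d → ℕ → Word d → Set where
  ≈-refl  : ∀ {k u} → u ≈[ k ] u
  ≈-sym   : ∀ {k u v} → u ≈[ k ] v → v ≈[ k ] u
  ≈-trans : ∀ {k u v w} → u ≈[ k ] v → v ≈[ k ] w → u ≈[ k ] w
  ≈-rel   : ∀ {k} u v (i : Fin (suc d)) → (u ++ replicate k i ++ v) ≈[ k ] (u ++ v)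

inv : ∀ {d} (k : ℕ) → Word d → Word d
inv k w = concatMap (λ i → replicate (k ∸ 1) i) (reverse w)

record IsSubgroup (d k : ℕ) (H : Word d → Set) : Set where
  field
    resp : ∀ {u v} → u ≈[ k ] v → H u → H v
    has-e : H []
    closed-mul : ∀ {u v} → H u → H v → H (u ++ v)
    closed-inv : ∀ {u} → H u → H (inv k u)

module Complex (d k : ℕ) (H : Word d → Set) where

  -- x ∈ K_{Ĵ} g  (K_{Ĵ} generated by α_j, j ∉ J)
  InCoset : Word d → Subset (suc d) → Word d → Set
  InCoset x J g = ∃ λ (u : Word d) → All (λ j → j ∉ J) u × x ≈[ k ] (u ++ g)

  CosetEq : Subset (suc d) → Word d → Word d → Set
  CosetEq J x y = ∀ z → (InCoset z J x → InCoset z J y) × (InCoset z J y → InCoset z J x)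

  -- a coset K_{Ĵ} g is represented by the pair (J , g)
  Cell : Set
  Cell = Subset (suc d) × Word d

  -- (J,g) and (J',g') equivalent: J = J' and {K_Ĵ g h : h ∈ H} = {K_Ĵ' g' h : h ∈ H}
  SameClass : Cell → Cell → Set
  SameClass (J , g) (J' , g') =
    J ≡ J' ×
    ((∀ h → H h → ∃ λ h' → H h' × CosetEq J (g ++ h) (g' ++ h')) ×
     (∀ h' → H h' → ∃ λ h → H h × CosetEq J (g' ++ h') (g ++ h)))

  -- a is in the (multi)boundary of b: a = [K_{(J∖l)^} g]_H with b = [K_Ĵ g]_H, l ∈ J
  Bd : Cell → Cell → Set
  Bd a (J , g) = ∃ λ l → ∃ λ g' → l ∈ J × SameClass (J , g') (J , g) × SameClass a (J - l , g')

  _⪯_ : Cell → Cell → Set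
  a ⪯ b = Star (λ x y → SameClass x y ⊎ Bd x y) a b

  dimPlus1 : Cell → ℕ
  dimPlus1 (J , g) = ∣ J ∣

  LinkVertex : Cell → Cell → Set
  LinkVertex a b = a ⪯ b × dimPlus1 b ≡ suc (dimPlus1 a)

  LinkEdge : Cell → Cell → Set
  LinkEdge a c = a ⪯ c × dimPlus1 c ≡ suc (suc (dimPlus1 a))

  LinkStep : Cell → Cell → Cell → Set
  LinkStep a x y = LinkVertex a x × LinkVertex a y ×
    (SameClass x y ⊎ (∃ λ c → LinkEdge a c × x ⪯ c × y ⪯ c))

  LinkConnected : Set
  LinkConnected = ∀ (a : Cell) → dimPlus1 a + 1 ≤ d →
    ∀ b b' → LinkVertex a b → LinkVertex a b' → Star (LinkStep a) b b'

module Submission where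

-- Let a = [K_Ĵ g]_H with |J| ≤ d - 1.  Every 0-multicell of its link is the class of a coset
-- K_{(J∪i)^} u g with i ∉ J and u a word in the generators α_m, m ∉ J.  Inside the link a letter
-- α_m ≠ α_i of u is absorbed into K_{(J∪i)^}; a letter α_i is absorbed after moving to the
-- neighbouring vertex for some j ∉ J ∪ {i}, which exists because |J| + 2 ≤ d + 1.  So every vertex
-- is joined to some [K_{(J∪i)^} g]_H, and any two of these lie in the 1-multicell [K_{(J∪{i,i'})^} g]_H.

open import Defs
open import Data.Nat using (ℕ; zero; suc; _∸_; _≤_; s≤s)
open import Data.Nat.Properties using (suc-injective; +-comm; ≤-trans; <-irrefl)
open import Data.Fin using (Fin; zero; suc; _≟_)
import Data.Fin.Properties as Fin
open import Data.Fin.Subset using (Subset; _∈_; _∉_; _-_; ∣_∣; _∪_; ⁅_⁆; _⊆_; ⊥; _─_; inside; outside)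
open import Data.Fin.Subset.Properties
  using (x∈p∪q⁺; x∈p∪q⁻; x∈⁅x⁆; x∈⁅y⁆⇒x≡y; p─q⊆p; p─⊥≡p; ∪-assoc; ∪-comm; ∪-identityʳ;
         p⊆q⇒∣p∣≤∣q∣; drop-∷-⊆; ∣p∣≤∣x∷p∣; drop-there)
open import Data.Vec using ([]; _∷_; here; there)
open import Data.List using ([]; _∷_; _++_; replicate; reverse; concatMap)
open import Data.List.Properties using (++-assoc; ++-identityʳ; unfold-reverse; concatMap-++)
open import Data.List.Relation.Unary.All using (All; []; _∷_)
import Data.List.Relation.Unary.All as All
open import Data.List.Relation.Unary.All.Properties using (++⁺; replicate⁺)
open import Data.Product using (∃; _×_; _,_; proj₁; proj₂)
open import Data.Sum using (_⊎_; inj₁; inj₂; [_,_])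
open import Data.Empty using (⊥-elim)
open import Function using (_∘_)
open import Relation.Nullary using (yes; no)
open import Relation.Binary.PropositionalEquality using (_≡_; _≢_; refl; sym; trans; cong; subst; module ≡-Reasoning)
open import Relation.Binary.Construct.Closure.ReflexiveTransitive using (Star; ε; _◅_; _◅◅_)
import Relation.Binary.Construct.Closure.ReflexiveTransitive as Star
open import Relation.Binary.Bundles using (Setoid)
import Relation.Binary.Reasoning.Setoid as SetoidReasoning
open import Level using (0ℓ)

module _ {n : ℕ} where

  x∈p∪⁅x⁆ : ∀ (p : Subset n) x → x ∈ p ∪ ⁅ x ⁆
  x∈p∪⁅x⁆ p x = x∈p∪q⁺ (inj₂ (x∈⁅x⁆ x))

  x∉p∪⁅y⁆ : ∀ (p : Subset n) {x} y → x ∉ p → x ≢ y → x ∉ p ∪ ⁅ y ⁆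
  x∉p∪⁅y⁆ p y x∉p x≢y x∈ = [ x∉p , (λ x∈⁅y⁆ → x≢y (x∈⁅y⁆⇒x≡y y x∈⁅y⁆)) ] (x∈p∪q⁻ p ⁅ y ⁆ x∈)

  p∪⁅x⁆∪⁅y⁆≡p∪⁅y⁆∪⁅x⁆ : ∀ (p : Subset n) x y → (p ∪ ⁅ x ⁆) ∪ ⁅ y ⁆ ≡ (p ∪ ⁅ y ⁆) ∪ ⁅ x ⁆
  p∪⁅x⁆∪⁅y⁆≡p∪⁅y⁆∪⁅x⁆ p x y = trans (∪-assoc p ⁅ x ⁆ ⁅ y ⁆)
    (trans (cong (p ∪_) (∪-comm ⁅ x ⁆ ⁅ y ⁆)) (sym (∪-assoc p ⁅ y ⁆ ⁅ x ⁆)))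

x∉p⇒p∪⁅x⁆-x≡p : ∀ {n} (p : Subset n) x → x ∉ p → p ∪ ⁅ x ⁆ - x ≡ p
x∉p⇒p∪⁅x⁆-x≡p (inside ∷ p)  zero    x∉p = ⊥-elim (x∉p here)
x∉p⇒p∪⁅x⁆-x≡p (outside ∷ p) zero    _   = cong (outside ∷_) (trans (cong (_─ ⊥) (∪-identityʳ p)) (p─⊥≡p p))
x∉p⇒p∪⁅x⁆-x≡p (inside ∷ p)  (suc x) x∉p = cong (inside ∷_) (x∉p⇒p∪⁅x⁆-x≡p p x (x∉p ∘ there))
x∉p⇒p∪⁅x⁆-x≡p (outside ∷ p) (suc x) x∉p = cong (outside ∷_) (x∉p⇒p∪⁅x⁆-x≡p p x (x∉p ∘ there))

x∉p⇒∣p∪⁅x⁆∣≡1+∣p∣ : ∀ {n} (p : Subset n) x → x ∉ p → ∣ p ∪ ⁅ x ⁆ ∣ ≡ suc ∣ p ∣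
x∉p⇒∣p∪⁅x⁆∣≡1+∣p∣ (inside ∷ p)  zero    x∉p = ⊥-elim (x∉p here)
x∉p⇒∣p∪⁅x⁆∣≡1+∣p∣ (outside ∷ p) zero    _   = cong (suc ∘ ∣_∣) (∪-identityʳ p)
x∉p⇒∣p∪⁅x⁆∣≡1+∣p∣ (inside ∷ p)  (suc x) x∉p = cong suc (x∉p⇒∣p∪⁅x⁆∣≡1+∣p∣ p x (x∉p ∘ there))
x∉p⇒∣p∪⁅x⁆∣≡1+∣p∣ (outside ∷ p) (suc x) x∉p = x∉p⇒∣p∪⁅x⁆∣≡1+∣p∣ p x (x∉p ∘ there)

p⊆q∧∣q∣≡∣p∣⇒q≡p : ∀ {n} {p q : Subset n} → p ⊆ q → ∣ q ∣ ≡ ∣ p ∣ → q ≡ p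
p⊆q∧∣q∣≡∣p∣⇒q≡p {p = []}          {[]}          _   _ = refl
p⊆q∧∣q∣≡∣p∣⇒q≡p {p = outside ∷ p} {outside ∷ q} p⊆q e =
  cong (outside ∷_) (p⊆q∧∣q∣≡∣p∣⇒q≡p (drop-∷-⊆ p⊆q) e)
p⊆q∧∣q∣≡∣p∣⇒q≡p {p = inside ∷ p}  {inside ∷ q}  p⊆q e =
  cong (inside ∷_) (p⊆q∧∣q∣≡∣p∣⇒q≡p (drop-∷-⊆ p⊆q) (suc-injective e))
p⊆q∧∣q∣≡∣p∣⇒q≡p {p = inside ∷ p}  {outside ∷ q} p⊆q _ with p⊆q here
... | ()
p⊆q∧∣q∣≡∣p∣⇒q≡p {p = outside ∷ p} {inside ∷ q}  p⊆q e =
  ⊥-elim (<-irrefl (sym e) (s≤s (p⊆q⇒∣p∣≤∣q∣ (drop-∷-⊆ p⊆q))))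

p⊆q∧∣q∣≡1+∣p∣⇒q≡p∪⁅x⁆ : ∀ {n} {p q : Subset n} → p ⊆ q → ∣ q ∣ ≡ suc ∣ p ∣ →
                         ∃ λ x → x ∉ p × q ≡ p ∪ ⁅ x ⁆
p⊆q∧∣q∣≡1+∣p∣⇒q≡p∪⁅x⁆ {p = []}          {[]}          _   ()
p⊆q∧∣q∣≡1+∣p∣⇒q≡p∪⁅x⁆ {p = outside ∷ p} {outside ∷ q} p⊆q e
  with x , x∉p , q≡ ← p⊆q∧∣q∣≡1+∣p∣⇒q≡p∪⁅x⁆ (drop-∷-⊆ p⊆q) e
  = suc x , (λ { (there x∈p) → x∉p x∈p }) , cong (outside ∷_) q≡
p⊆q∧∣q∣≡1+∣p∣⇒q≡p∪⁅x⁆ {p = inside ∷ p}  {inside ∷ q}  p⊆q e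
  with x , x∉p , q≡ ← p⊆q∧∣q∣≡1+∣p∣⇒q≡p∪⁅x⁆ (drop-∷-⊆ p⊆q) (suc-injective e)
  = suc x , (λ { (there x∈p) → x∉p x∈p }) , cong (inside ∷_) q≡
p⊆q∧∣q∣≡1+∣p∣⇒q≡p∪⁅x⁆ {p = inside ∷ p}  {outside ∷ q} p⊆q _ with p⊆q here
... | ()
p⊆q∧∣q∣≡1+∣p∣⇒q≡p∪⁅x⁆ {p = outside ∷ p} {inside ∷ q}  p⊆q e =
  zero , (λ ()) ,
  cong (inside ∷_) (trans (p⊆q∧∣q∣≡∣p∣⇒q≡p (drop-∷-⊆ p⊆q) (suc-injective e)) (sym (∪-identityʳ p)))

∣p∣<n⇒∃x∉p : ∀ {n} (p : Subset n) → suc ∣ p ∣ ≤ n → ∃ λ x → x ∉ p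
∣p∣<n⇒∃x∉p (outside ∷ p) _ = zero , λ ()
∣p∣<n⇒∃x∉p (inside ∷ p) (s≤s ∣p∣<n) with x , x∉p ← ∣p∣<n⇒∃x∉p p ∣p∣<n = suc x , x∉p ∘ drop-there

1+∣p∣<n⇒∃x∉p∧x≢y : ∀ {n} (p : Subset n) y → suc (suc ∣ p ∣) ≤ n → ∃ λ x → x ∉ p × x ≢ y
1+∣p∣<n⇒∃x∉p∧x≢y (s ∷ p) zero (s≤s 1+∣p∣<n)
  with x , x∉p ← ∣p∣<n⇒∃x∉p p (≤-trans (s≤s (∣p∣≤∣x∷p∣ s p)) 1+∣p∣<n)
  = suc x , x∉p ∘ drop-there , λ ()
1+∣p∣<n⇒∃x∉p∧x≢y (outside ∷ p) (suc y) _ = zero , (λ ()) , (λ ())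
1+∣p∣<n⇒∃x∉p∧x≢y (inside ∷ p) (suc y) (s≤s 1+∣p∣<n)
  with x , x∉p , x≢y ← 1+∣p∣<n⇒∃x∉p∧x≢y p y 1+∣p∣<n
  = suc x , x∉p ∘ drop-there , x≢y ∘ Fin.suc-injective

module _ {d k : ℕ} where

  private
    infix 4 _≈_
    _≈_ : Word d → Word d → Set
    u ≈ v = u ≈[ k ] v

  ≈-setoid : Setoid 0ℓ 0ℓ
  ≈-setoid = record
    { Carrier       = Word d
    ; _≈_           = _≈_
    ; isEquivalence = record { refl = ≈-refl ; sym = ≈-sym ; trans = ≈-trans }
    }

  ≡⇒≈ : ∀ {u v : Word d} → u ≡ v → u ≈ v
  ≡⇒≈ refl = ≈-refl

  ++-congˡ : ∀ (w : Word d) {u v} → u ≈ v → w ++ u ≈ w ++ v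
  ++-congˡ w ≈-refl        = ≈-refl
  ++-congˡ w (≈-sym p)     = ≈-sym (++-congˡ w p)
  ++-congˡ w (≈-trans p q) = ≈-trans (++-congˡ w p) (++-congˡ w q)
  ++-congˡ w (≈-rel u v i) =
    ≈-trans (≡⇒≈ (sym (++-assoc w u _)))
      (≈-trans (≈-rel (w ++ u) v i) (≡⇒≈ (++-assoc w u v)))

  ++-congʳ : ∀ (w : Word d) {u v} → u ≈ v → u ++ w ≈ v ++ w
  ++-congʳ w ≈-refl        = ≈-refl
  ++-congʳ w (≈-sym p)     = ≈-sym (++-congʳ w p)
  ++-congʳ w (≈-trans p q) = ≈-trans (++-congʳ w p) (++-congʳ w q)
  ++-congʳ w (≈-rel u v i) =
    ≈-trans (≡⇒≈ (trans (++-assoc u _ w) (cong (u ++_) (++-assoc (replicate k i) v w))))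
      (≈-trans (≈-rel u (v ++ w) i) (≡⇒≈ (sym (++-assoc u v w))))

  inv-∷ : ∀ i (w : Word d) → inv k (i ∷ w) ≡ inv k w ++ replicate (k ∸ 1) i
  inv-∷ i w = begin
    concatMap (replicate (k ∸ 1)) (reverse (i ∷ w))      ≡⟨ cong (concatMap _) (unfold-reverse i w) ⟩
    concatMap (replicate (k ∸ 1)) (reverse w ++ i ∷ [])  ≡⟨ concatMap-++ _ (reverse w) (i ∷ []) ⟩
    inv k w ++ replicate (k ∸ 1) i ++ []                 ≡⟨ cong (inv k w ++_) (++-identityʳ _) ⟩
    inv k w ++ replicate (k ∸ 1) i                       ∎
    where open ≡-Reasoning

  All-inv : ∀ {P : Fin (suc d) → Set} {w : Word d} → All P w → All P (inv k w)
  All-inv {w = []}    []       = []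
  All-inv {P} {i ∷ w} (p ∷ ps) = subst (All P) (sym (inv-∷ i w)) (++⁺ (All-inv ps) (replicate⁺ (k ∸ 1) p))

replicate-++-∷ : ∀ {A : Set} n (x : A) ys → replicate n x ++ x ∷ ys ≡ x ∷ replicate n x ++ ys
replicate-++-∷ zero    x ys = refl
replicate-++-∷ (suc n) x ys = cong (x ∷_) (replicate-++-∷ n x ys)

module _ {d k : ℕ} where

  private
    infix 4 _≈_
    _≈_ : Word d → Word d → Set
    u ≈ v = u ≈[ suc k ] v

  inverseʳ : ∀ (w : Word d) → w ++ inv (suc k) w ≈ []
  inverseʳ []      = ≈-refl
  inverseʳ (i ∷ w) = begin
    i ∷ w ++ inv (suc k) (i ∷ w)               ≡⟨ cong (λ v → i ∷ w ++ v) (inv-∷ {k = suc k} i w) ⟩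
    i ∷ w ++ inv (suc k) w ++ replicate k i    ≡⟨ cong (i ∷_) (sym (++-assoc w _ _)) ⟩
    i ∷ (w ++ inv (suc k) w) ++ replicate k i  ≈⟨ ++-congˡ (i ∷ []) (++-congʳ (replicate k i) (inverseʳ w)) ⟩
    replicate (suc k) i                        ≡⟨ sym (++-identityʳ _) ⟩
    replicate (suc k) i ++ []                  ≈⟨ ≈-rel [] [] i ⟩
    []                                         ∎
    where open SetoidReasoning (≈-setoid {d} {suc k})

  inverseˡ : ∀ (w : Word d) → inv (suc k) w ++ w ≈ []
  inverseˡ []      = ≈-refl
  inverseˡ (i ∷ w) = begin
    inv (suc k) (i ∷ w) ++ i ∷ w               ≡⟨ cong (_++ i ∷ w) (inv-∷ {k = suc k} i w) ⟩
    (inv (suc k) w ++ replicate k i) ++ i ∷ w  ≡⟨ ++-assoc (inv (suc k) w) _ _ ⟩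
    inv (suc k) w ++ replicate k i ++ i ∷ w    ≡⟨ cong (inv (suc k) w ++_) (replicate-++-∷ k i w) ⟩
    inv (suc k) w ++ replicate (suc k) i ++ w  ≈⟨ ≈-rel (inv (suc k) w) w i ⟩
    inv (suc k) w ++ w                         ≈⟨ inverseˡ w ⟩
    []                                         ∎
    where open SetoidReasoning (≈-setoid {d} {suc k})

module Classes {d k : ℕ} {H : Word d → Set} (H≤G : IsSubgroup d (suc k) H) where

  open Complex d (suc k) H
  open IsSubgroup H≤G

  private
    infix 4 _≈_
    _≈_ : Word d → Word d → Set
    u ≈ v = u ≈[ suc k ] v

  CosetEq-refl : ∀ {J} x → CosetEq J x x
  CosetEq-refl x z = (λ z∈ → z∈) , (λ z∈ → z∈)

  CosetEq-sym : ∀ {J x y} → CosetEq J x y → CosetEq J y x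
  CosetEq-sym x~y z = proj₂ (x~y z) , proj₁ (x~y z)

  CosetEq-trans : ∀ {J x y w} → CosetEq J x y → CosetEq J y w → CosetEq J x w
  CosetEq-trans x~y y~w z = proj₁ (y~w z) ∘ proj₁ (x~y z) , proj₂ (x~y z) ∘ proj₂ (y~w z)

  InCoset-resp-≈ : ∀ {J x y z} → x ≈ y → InCoset z J x → InCoset z J y
  InCoset-resp-≈ x≈y (u , u∈K , z≈ux) = u , u∈K , ≈-trans z≈ux (++-congˡ u x≈y)

  ≈⇒CosetEq : ∀ {J x y} → x ≈ y → CosetEq J x y
  ≈⇒CosetEq x≈y z = InCoset-resp-≈ x≈y , InCoset-resp-≈ (≈-sym x≈y)

  CosetEq-absorb : ∀ {J} {u : Word d} x → All (_∉ J) u → CosetEq J (u ++ x) x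
  CosetEq-absorb {u = u} x u∈K z =
    (λ { (v , v∈K , z≈vux) → v ++ u , ++⁺ v∈K u∈K , ≈-trans z≈vux (≡⇒≈ (sym (++-assoc v u x))) }) ,
    (λ { (v , v∈K , z≈vx) → v ++ inv (suc k) u , ++⁺ v∈K (All-inv {k = suc k} u∈K) , ≈-trans z≈vx (vx≈vu⁻¹ux v) })
    where
    open SetoidReasoning (≈-setoid {d} {suc k})
    vx≈vu⁻¹ux : ∀ v → v ++ x ≈ (v ++ inv (suc k) u) ++ u ++ x
    vx≈vu⁻¹ux v = begin
      v ++ x                              ≈⟨ ++-congˡ v (++-congʳ x (≈-sym (inverseˡ u))) ⟩
      v ++ (inv (suc k) u ++ u) ++ x      ≡⟨ cong (v ++_) (++-assoc (inv (suc k) u) u x) ⟩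
      v ++ inv (suc k) u ++ u ++ x        ≡⟨ sym (++-assoc v (inv (suc k) u) (u ++ x)) ⟩
      (v ++ inv (suc k) u) ++ u ++ x      ∎

  SameClass-refl : ∀ a → SameClass a a
  SameClass-refl (_ , _) = refl , (λ h h∈H → h , h∈H , CosetEq-refl _) , (λ h h∈H → h , h∈H , CosetEq-refl _)

  SameClass-sym : ∀ {a b} → SameClass a b → SameClass b a
  SameClass-sym {J , _} {.J , _} (refl , a→b , b→a) = refl , b→a , a→b

  SameClass-trans : ∀ {a b c} → SameClass a b → SameClass b c → SameClass a c
  SameClass-trans {J , _} {.J , _} {.J , _} (refl , a→b , b→a) (refl , b→c , c→b) =
    refl , compose a→b b→c , compose c→b b→a
    where
    compose : ∀ {x y z} →
      (∀ h → H h → ∃ λ h' → H h' × CosetEq J (x ++ h) (y ++ h')) →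
      (∀ h → H h → ∃ λ h' → H h' × CosetEq J (y ++ h) (z ++ h')) →
      (∀ h → H h → ∃ λ h' → H h' × CosetEq J (x ++ h) (z ++ h'))
    compose x→y y→z h h∈H
      with h' , h'∈H , xh~yh' ← x→y h h∈H
      with h'' , h''∈H , yh'~zh'' ← y→z h' h'∈H
      = h'' , h''∈H , CosetEq-trans xh~yh' yh'~zh''

  SameClass-setoid : Setoid 0ℓ 0ℓ
  SameClass-setoid = record
    { Carrier       = Cell
    ; _≈_           = SameClass
    ; isEquivalence = record { refl = SameClass-refl _ ; sym = SameClass-sym ; trans = SameClass-trans }
    }

  ≡⇒SameClass : ∀ {J J'} {g : Word d} → J ≡ J' → SameClass (J , g) (J' , g)
  ≡⇒SameClass refl = SameClass-refl _

  ≈⇒SameClass : ∀ {J} {x y : Word d} → x ≈ y → SameClass (J , x) (J , y)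
  ≈⇒SameClass x≈y =
    refl , (λ h h∈H → h , h∈H , ≈⇒CosetEq (++-congʳ h x≈y)) ,
           (λ h h∈H → h , h∈H , ≈⇒CosetEq (++-congʳ h (≈-sym x≈y)))

  SameClass-absorbˡ : ∀ {J} {u : Word d} x → All (_∉ J) u → SameClass (J , u ++ x) (J , x)
  SameClass-absorbˡ {u = u} x u∈K =
    refl , (λ h h∈H → h , h∈H , uxh~xh h) , (λ h h∈H → h , h∈H , CosetEq-sym (uxh~xh h))
    where
    uxh~xh : ∀ h → CosetEq _ ((u ++ x) ++ h) (x ++ h)
    uxh~xh h = subst (λ w → CosetEq _ w (x ++ h)) (sym (++-assoc u x h)) (CosetEq-absorb (x ++ h) u∈K)

  SameClass-absorbʳ : ∀ {J} x {h : Word d} → H h → SameClass (J , x ++ h) (J , x)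
  SameClass-absorbʳ x {h} h∈H =
    refl , (λ h' h'∈H → h ++ h' , closed-mul h∈H h'∈H , ≈⇒CosetEq (≡⇒≈ (++-assoc x h h'))) ,
           (λ h' h'∈H → inv (suc k) h ++ h' , closed-mul (closed-inv h∈H) h'∈H , ≈⇒CosetEq (xh'≈xhh⁻¹h' h'))
    where
    open SetoidReasoning (≈-setoid {d} {suc k})
    xh'≈xhh⁻¹h' : ∀ h' → x ++ h' ≈ (x ++ h) ++ inv (suc k) h ++ h'
    xh'≈xhh⁻¹h' h' = begin
      x ++ h'                               ≈⟨ ++-congˡ x (++-congʳ h' (≈-sym (inverseʳ h))) ⟩
      x ++ (h ++ inv (suc k) h) ++ h'       ≡⟨ cong (x ++_) (++-assoc h (inv (suc k) h) h') ⟩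
      x ++ h ++ inv (suc k) h ++ h'         ≡⟨ sym (++-assoc x h (inv (suc k) h ++ h')) ⟩
      (x ++ h) ++ inv (suc k) h ++ h'       ∎

  SameClass⇒∈double-coset : ∀ {J} {x y : Word d} → SameClass (J , x) (J , y) →
    ∃ λ u → ∃ λ h → All (_∉ J) u × H h × y ≈ u ++ x ++ h
  SameClass⇒∈double-coset {y = y} (_ , _ , y→x)
    with h , h∈H , y~xh ← y→x [] has-e
    with u , u∈K , y≈uxh ← proj₁ (y~xh (y ++ [])) ([] , [] , ≈-refl)
    = u , h , u∈K , h∈H , ≈-trans (≡⇒≈ (sym (++-identityʳ y))) y≈uxh

  -- The shape of every b with [K_Ĵ g]_H ⪯ b: the class of a coset K_Ĵ' u g with J ⊆ J' and u ∈ K_Ĵ.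
  Above : Cell → Cell → Set
  Above (J , g) (J' , g') = J ⊆ J' × ∃ λ u → All (_∉ J) u × SameClass (J' , g') (J' , u ++ g)

  Above-refl : ∀ a → Above a a
  Above-refl (_ , _) = (λ j∈J → j∈J) , [] , [] , SameClass-refl _

  Above-step : ∀ {a b c} → Above a b → SameClass b c ⊎ Bd b c → Above a c
  Above-step (J⊆J' , u , u∈K , b~ug) (inj₁ b~c@(refl , _)) =
    J⊆J' , u , u∈K , SameClass-trans (SameClass-sym b~c) b~ug
  Above-step {J , g} {_} {J'' , g''} (J⊆J' , u , u∈K , b~ug) (inj₂ (l , w , _ , c~w , b~w@(refl , _)))
    with v , h , v∈K' , h∈H , w≈vugh ← SameClass⇒∈double-coset (SameClass-trans (SameClass-sym b~ug) b~w)
    = p─q⊆p J'' ⁅ l ⁆ ∘ J⊆J' , v ++ u , ++⁺ (All.map (_∘ J⊆J') v∈K') u∈K , c~vug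
    where
    reassociate : v ++ (u ++ g) ++ h ≡ ((v ++ u) ++ g) ++ h
    reassociate = trans (cong (v ++_) (++-assoc u g h))
      (sym (trans (++-assoc (v ++ u) g h) (++-assoc v u (g ++ h))))
    open SetoidReasoning SameClass-setoid
    c~vug : SameClass (J'' , g'') (J'' , (v ++ u) ++ g)
    c~vug = begin
      J'' , g''                         ≈⟨ SameClass-sym c~w ⟩
      J'' , w                           ≈⟨ ≈⇒SameClass (≈-trans w≈vugh (≡⇒≈ reassociate)) ⟩
      J'' , ((v ++ u) ++ g) ++ h        ≈⟨ SameClass-absorbʳ ((v ++ u) ++ g) h∈H ⟩
      J'' , (v ++ u) ++ g               ∎

  Above-⪯ : ∀ {a b c} → Above a b → b ⪯ c → Above a c
  Above-⪯ a≤b ε              = a≤b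
  Above-⪯ a≤b (step ◅ steps) = Above-⪯ (Above-step a≤b step) steps

  ⪯⇒Above : ∀ {a b} → a ⪯ b → Above a b
  ⪯⇒Above = Above-⪯ (Above-refl _)

  Bd-insert : ∀ {J x i} → i ∉ J → Bd (J , x) (J ∪ ⁅ i ⁆ , x)
  Bd-insert {J} {x} {i} i∉J =
    i , x , x∈p∪⁅x⁆ J i , SameClass-refl _ , ≡⇒SameClass (sym (x∉p⇒p∪⁅x⁆-x≡p J i i∉J))

  LinkStep-sym : ∀ {a x y} → LinkStep a x y → LinkStep a y x
  LinkStep-sym (x∈ , y∈ , inj₁ x~y)                 = y∈ , x∈ , inj₁ (SameClass-sym x~y)
  LinkStep-sym (x∈ , y∈ , inj₂ (c , c∈ , x⪯c , y⪯c)) = y∈ , x∈ , inj₂ (c , c∈ , y⪯c , x⪯c)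

  module Link (J : Subset (suc d)) (g : Word d) where

    base : Cell
    base = J , g

    vertex : Fin (suc d) → Word d → Cell
    vertex i u = J ∪ ⁅ i ⁆ , u ++ g

    vertex∈link : ∀ {i u} → i ∉ J → All (_∉ J) u → LinkVertex base (vertex i u)
    vertex∈link {i} i∉J u∈K =
      inj₁ (SameClass-sym (SameClass-absorbˡ g u∈K)) ◅ inj₂ (Bd-insert i∉J) ◅ ε ,
      x∉p⇒∣p∪⁅x⁆∣≡1+∣p∣ J i i∉J

    edge : ∀ {i j u} → i ∉ J → j ∉ J → i ≢ j → All (_∉ J) u → LinkStep base (vertex i u) (vertex j u)
    edge {i} {j} {u} i∉J j∉J i≢j u∈K =
      vertex∈link i∉J u∈K , vertex∈link j∉J u∈K ,
      inj₂ (cell , (proj₁ (vertex∈link i∉J u∈K) ◅◅ i⪯cell , ∣cell∣) , i⪯cell , j⪯cell)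
      where
      cell : Cell
      cell = (J ∪ ⁅ i ⁆) ∪ ⁅ j ⁆ , u ++ g
      j∉J∪i : j ∉ J ∪ ⁅ i ⁆
      j∉J∪i = x∉p∪⁅y⁆ J i j∉J (i≢j ∘ sym)
      i∉J∪j : i ∉ J ∪ ⁅ j ⁆
      i∉J∪j = x∉p∪⁅y⁆ J j i∉J i≢j
      i⪯cell : vertex i u ⪯ cell
      i⪯cell = inj₂ (Bd-insert j∉J∪i) ◅ ε
      j⪯cell : vertex j u ⪯ cell
      j⪯cell = inj₂ (subst (λ S → Bd (vertex j u) (S , u ++ g)) (p∪⁅x⁆∪⁅y⁆≡p∪⁅y⁆∪⁅x⁆ J j i) (Bd-insert i∉J∪j)) ◅ ε
      ∣cell∣ : ∣ (J ∪ ⁅ i ⁆) ∪ ⁅ j ⁆ ∣ ≡ suc (suc ∣ J ∣)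
      ∣cell∣ = trans (x∉p⇒∣p∪⁅x⁆∣≡1+∣p∣ (J ∪ ⁅ i ⁆) j j∉J∪i) (cong suc (x∉p⇒∣p∪⁅x⁆∣≡1+∣p∣ J i i∉J))

    absorb : ∀ {i m u} → i ∉ J → m ∉ J → m ≢ i → All (_∉ J) u →
             LinkStep base (vertex i (m ∷ u)) (vertex i u)
    absorb i∉J m∉J m≢i u∈K =
      vertex∈link i∉J (m∉J ∷ u∈K) , vertex∈link i∉J u∈K ,
      inj₁ (SameClass-absorbˡ {u = _ ∷ []} _ (x∉p∪⁅y⁆ J _ m∉J m≢i ∷ []))

    module _ (codim≥2 : suc (suc ∣ J ∣) ≤ suc d) where

      strip : ∀ {i u} → i ∉ J → All (_∉ J) u → Star (LinkStep base) (vertex i u) (vertex i [])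
      strip {u = []}    _   []           = ε
      strip {i} {m ∷ u} i∉J (m∉J ∷ u∈K) with m ≟ i
      ... | no m≢i  = absorb i∉J m∉J m≢i u∈K ◅ strip i∉J u∈K
      -- α_i is not in K_{(J ∪ i)^}: detour through a vertex j ∉ J ∪ {i}, whose subgroup does contain it.
      ... | yes refl with j , j∉J , j≢i ← 1+∣p∣<n⇒∃x∉p∧x≢y J i codim≥2 =
        edge i∉J j∉J (j≢i ∘ sym) (m∉J ∷ u∈K) ◅ absorb j∉J m∉J (j≢i ∘ sym) u∈K ◅
        LinkStep-sym (edge i∉J j∉J (j≢i ∘ sym) u∈K) ◅ strip i∉J u∈K

      vertex-normal-form : ∀ {b} → LinkVertex base b →
        ∃ λ i → ∃ λ u → i ∉ J × All (_∉ J) u × LinkStep base b (vertex i u)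
      vertex-normal-form {J' , g'} b∈@(base⪯b , ∣J'∣≡1+∣J∣)
        with J⊆J' , u , u∈K , b~ug ← ⪯⇒Above base⪯b
        with i , i∉J , J'≡J∪i ← p⊆q∧∣q∣≡1+∣p∣⇒q≡p∪⁅x⁆ J⊆J' ∣J'∣≡1+∣J∣
        = i , u , i∉J , u∈K , b∈ , vertex∈link i∉J u∈K , inj₁ (SameClass-trans b~ug (≡⇒SameClass J'≡J∪i))

      link-connected : ∀ {b b'} → LinkVertex base b → LinkVertex base b' → Star (LinkStep base) b b'
      link-connected b∈ b'∈
        with i , u , i∉J , u∈K , b-i ← vertex-normal-form b∈
        with i' , u' , i'∉J , u'∈K , b'-i' ← vertex-normal-form b'∈
        = b-i ◅ strip i∉J u∈K ◅◅ i-i' ◅◅ Star.reverse LinkStep-sym (strip i'∉J u'∈K) ◅◅ LinkStep-sym b'-i' ◅ ε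
        where
        i-i' : Star (LinkStep base) (vertex i []) (vertex i' [])
        i-i' with i ≟ i'
        ... | yes refl = ε
        ... | no i≢i'  = edge i∉J i'∉J i≢i' [] ◅ ε

proposition7p12 : (d k : ℕ) → 1 ≤ d → 1 ≤ k → (H : Word d → Set) → IsSubgroup d k H →
                    Complex.LinkConnected d k H
proposition7p12 d (suc k) _ (s≤s _) H H≤G (J , g) ∣J∣+1≤d _ _ =
  Link.link-connected J g (s≤s (subst (_≤ d) (+-comm ∣ J ∣ 1) ∣J∣+1≤d))
  where open Classes H≤G
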